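{- Let $G$ be a finite simple graph with no isolated vertices and minimum degree $\delta(G)$. (1) If $\delta(G)\ge2$, then $t(G)=t_e(G)$. (2) If $\delta(G)=1$ and no connected component of $G$ is a single edge, then $t_e(G)\le t(G)\le t_e(G)+1$. (3) If $\delta(G)=1$, then $t_e(G)\le t(G)\le t_e(G)+2$.
   Context: For a finite simple graph $G$, a family of subsets $B_v\subseteq[1,t]=\{1,\dots,t\}$, one for each vertex $v$, is a $G$-ECFF$(t,|V(G)|)$ if for every edge $\{a,b\}$ and every vertex $w\notin\{a,b\}$, $B_w\not\subseteq B_a\cup B_b$; it is a $G$-CFF$(t,|V(G)|)$ if in addition $B_a\not\subseteq B_b$ and $B_b\not\subseteq B_a$ for every edge $\{a,b\}$. $t_e(G)$ and $t(G)$ denote the minimum $t$ for which a $G$-ECFF$(t,|V(G)|)$, respectively a $G$-CFF$(t,|V(G)|)$, exists. -}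

module Defs where

open import Data.Nat using (ℕ; _<_; _≤_; _+_)
open import Data.Bool using (Bool; true; false; if_then_else_)
open import Data.Fin using (Fin)
open import Data.Fin.Subset using (Subset; _⊆_; _∪_; ∣_∣; inside; outside)
open import Data.Vec using (tabulate)
open import Data.Product using (Σ; ∃; _×_)
open import Relation.Nullary using (¬_)
open import Relation.Binary.PropositionalEquality using (_≡_; _≢_)

record Graph : Set where
  field
    n     : ℕ
    adj   : Fin n → Fin n → Bool
    sym   : ∀ a b → adj a b ≡ adj b a
    irrefl : ∀ a → adj a a ≡ false
open Graph public

Edge : (G : Graph) → Fin (n G) → Fin (n G) → Set
Edge G a b = adj G a b ≡ true

N : (G : Graph) → Fin (n G) → Subset (n G)
N G v = tabulate (λ w → if adj G v w then inside else outside)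

deg : (G : Graph) → Fin (n G) → ℕ
deg G v = ∣ N G v ∣

NoIsolated : Graph → Set
NoIsolated G = ∀ v → 1 ≤ deg G v

MinDegree : (G : Graph) → ℕ → Set
MinDegree G d = (∀ v → d ≤ deg G v) × ∃ (λ v → deg G v ≡ d)

MinDegree≥ : (G : Graph) → ℕ → Set
MinDegree≥ G d = ∀ v → d ≤ deg G v

-- some connected component of G is a single edge (a copy of K₂):
-- an edge both of whose endpoints have degree 1
HasK2Component : Graph → Set
HasK2Component G = Σ (Fin (n G)) λ a → Σ (Fin (n G)) λ b →
  Edge G a b × deg G a ≡ 1 × deg G b ≡ 1

IsECFF : (G : Graph) (t : ℕ) → (Fin (n G) → Subset t) → Set
IsECFF G t B = ∀ a b w → Edge G a b → w ≢ a → w ≢ b →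
  ¬ (B w ⊆ (B a ∪ B b))

IsCFF : (G : Graph) (t : ℕ) → (Fin (n G) → Subset t) → Set
IsCFF G t B = IsECFF G t B ×
  (∀ a b → Edge G a b → ¬ (B a ⊆ B b) × ¬ (B b ⊆ B a))

HasECFF : Graph → ℕ → Set
HasECFF G t = Σ (Fin (n G) → Subset t) (IsECFF G t)

HasCFF : Graph → ℕ → Set
HasCFF G t = Σ (Fin (n G) → Subset t) (IsCFF G t)

IsTe : Graph → ℕ → Set
IsTe G m = HasECFF G m × (∀ k → k < m → ¬ HasECFF G k)

IsT : Graph → ℕ → Set
IsT G m = HasCFF G m × (∀ k → k < m → ¬ HasCFF G k)

module Submission where

-- Every G-CFF is a G-ECFF, so t_e ≤ t. Conversely, in a G-ECFF an inclusion
-- B a ⊆ B b along an edge ab is impossible as soon as b has a second neighbour c,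
-- for then B a ⊆ B b ∪ B c. Hence a G-ECFF is a G-CFF when δ(G) ≥ 2, and in
-- general it becomes one after prefixing every B v with a short code that
-- separates the ends of each edge at a vertex of degree 1: one bit marking
-- degree ≥ 2 works when there is no K₂ component, and two bits, which also
-- record whether v has a larger neighbour, separate the two ends of a K₂.

open import Defs hiding (sym)
open import Data.Nat using (ℕ; _≤_; _<_; _+_; _≤?_; s≤s; s≤s⁻¹)
open import Data.Nat.Properties
  using (≤-antisym; ≤-trans; ≮⇒≥; <⇒≱; ≰⇒>; +-comm)
open import Data.Bool using (Bool; true; false; not; _≟_; if_then_else_)
open import Data.Bool.Properties using (not-¬)
open import Data.Fin as Fin using (Fin)
open import Data.Fin.Properties using (any?; <-cmp; <-asym)
open import Data.Fin.Subset
  using (Subset; _⊆_; _⊈_; _∪_; _∈_; _-_; ∣_∣; ⁅_⁆; ⊤; inside; outside)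
open import Data.Fin.Subset.Properties
  using (drop-∷-⊆; p⊆p∪q; p⊆q⇒∣p∣≤∣q∣; ∣⁅x⁆∣≡1; x∈⁅x⁆; x∈⁅y⁆⇒x≡y;
         x∈p∧x≢y⇒x∈p-y; x∈p⇒∣p-x∣<∣p∣)
open import Data.Vec using ([]; _∷_; _++_; here; there)
open import Data.Vec.Properties using (lookup∘tabulate; lookup⇒[]=; []=⇒lookup; zipWith-++)
open import Data.Empty using (⊥-elim)
open import Data.Product using (∃; _×_; _,_)
open import Function.Bundles using (mk⇔)
open import Relation.Binary using (tri<; tri≈; tri>)
open import Relation.Nullary using (¬_; Dec; yes; no; does; _×-dec_; contradiction)
open import Relation.Nullary.Decidable using (dec-true; dec-false; does-⇔)
open import Relation.Binary.PropositionalEquality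
  using (_≡_; _≢_; refl; sym; trans; cong; subst; module ≡-Reasoning)

x∈p∧y∈p∧y≢x⇒2≤∣p∣ : ∀ {m} {p : Subset m} {x y} → x ∈ p → y ∈ p → y ≢ x → 2 ≤ ∣ p ∣
x∈p∧y∈p∧y≢x⇒2≤∣p∣ {p = p} {x} {y} x∈p y∈p y≢x =
  ≤-trans (s≤s 1≤∣p-x∣) (x∈p⇒∣p-x∣<∣p∣ x∈p)
  where
  1≤∣p-x∣ : 1 ≤ ∣ p - x ∣
  1≤∣p-x∣ = subst (_≤ ∣ p - x ∣) (∣⁅x⁆∣≡1 y)
    (p⊆q⇒∣p∣≤∣q∣ λ z∈⁅y⁆ →
      subst (_∈ p - x) (sym (x∈⁅y⁆⇒x≡y y z∈⁅y⁆)) (x∈p∧x≢y⇒x∈p-y y∈p y≢x))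

p⊆⁅x⁆⇒∣p∣≤1 : ∀ {m} {p : Subset m} {x} → p ⊆ ⁅ x ⁆ → ∣ p ∣ ≤ 1
p⊆⁅x⁆⇒∣p∣≤1 {x = x} p⊆⁅x⁆ = subst (_ ≤_) (∣⁅x⁆∣≡1 x) (p⊆q⇒∣p∣≤∣q∣ p⊆⁅x⁆)

∷-⊈ : ∀ {m x y} {p q : Subset m} → x ≡ true → y ≡ false → x ∷ p ⊈ y ∷ q
∷-⊈ refl refl x∷p⊆y∷q with x∷p⊆y∷q here
... | ()

++-⊆⁻ˡ : ∀ {k t} (p p′ : Subset k) {q q′ : Subset t} → p ++ q ⊆ p′ ++ q′ → p ⊆ p′
++-⊆⁻ˡ (x ∷ p) (x′ ∷ p′) incl here with incl here
... | here = here
++-⊆⁻ˡ (x ∷ p) (x′ ∷ p′) incl (there i∈p) = there (++-⊆⁻ˡ p p′ (drop-∷-⊆ incl) i∈p)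

++-⊆⁻ʳ : ∀ {k t} (p p′ : Subset k) {q q′ : Subset t} → p ++ q ⊆ p′ ++ q′ → q ⊆ q′
++-⊆⁻ʳ []      []        incl = incl
++-⊆⁻ʳ (_ ∷ p) (_ ∷ p′) incl = ++-⊆⁻ʳ p p′ (drop-∷-⊆ incl)

orient : Bool → Bool → Subset 2
orient true  _ = ⊤
orient false u = u ∷ not u ∷ []

orient-⊈ : ∀ {α β} u u′ → α ≡ true → β ≡ false → orient α u ⊈ orient β u′
orient-⊈ u true  refl refl incl = ∷-⊈ refl refl (drop-∷-⊆ incl)
orient-⊈ u false refl refl incl = ∷-⊈ refl refl incl

orient-⊆⇒≡ : ∀ {α β} u u′ → α ≡ false → β ≡ false → orient α u ⊆ orient β u′ → u ≡ u′
orient-⊆⇒≡ true  true  refl refl _ = refl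
orient-⊆⇒≡ true  false refl refl incl = ⊥-elim (∷-⊈ refl refl incl)
orient-⊆⇒≡ false true  refl refl incl = ⊥-elim (∷-⊈ refl refl (drop-∷-⊆ incl))
orient-⊆⇒≡ false false refl refl _ = refl

does-<?-flip : ∀ {m} {i j : Fin m} → i ≢ j → does (i Fin.<? j) ≡ not (does (j Fin.<? i))
does-<?-flip {i = i} {j} i≢j with <-cmp i j
... | tri< i<j _ _ = trans (dec-true (i Fin.<? j) i<j) (cong not (sym (dec-false (j Fin.<? i) (<-asym i<j))))
... | tri≈ _ i≡j _ = contradiction i≡j i≢j
... | tri> _ _ j<i = trans (dec-false (i Fin.<? j) (<-asym j<i)) (cong not (sym (dec-true (j Fin.<? i) j<i)))

module _ (G : Graph) where

  Edge-sym : ∀ {a b} → Edge G a b → Edge G b a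
  Edge-sym {a} {b} e = trans (Graph.sym G b a) e

  Edge-irrefl : ∀ {a b} → Edge G a b → a ≢ b
  Edge-irrefl {a} e refl with trans (sym (irrefl G a)) e
  ... | ()

  Edge⇒∈N : ∀ {v u} → Edge G v u → u ∈ N G v
  Edge⇒∈N {v} {u} e = lookup⇒[]= u (N G v)
    (trans (lookup∘tabulate _ u) (cong (λ b → if b then inside else outside) e))

  ∈N⇒Edge : ∀ {v u} → u ∈ N G v → Edge G v u
  ∈N⇒Edge {v} {u} u∈N with adj G v u | trans (sym (lookup∘tabulate _ u)) ([]=⇒lookup u∈N)
  ... | true  | _ = refl
  ... | false | ()

  neighbours≡⇒deg≤1 : ∀ {v u} → (∀ w → Edge G v w → w ≡ u) → deg G v ≤ 1
  neighbours≡⇒deg≤1 {u = u} unique =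
    p⊆⁅x⁆⇒∣p∣≤1 λ w∈N → subst (_∈ ⁅ u ⁆) (sym (unique _ (∈N⇒Edge w∈N))) (x∈⁅x⁆ u)

  leaf-neighbour-unique : ∀ {v u w} → deg G v < 2 → Edge G v u → Edge G v w → w ≡ u
  leaf-neighbour-unique {u = u} {w} v-leaf e e′ with w Fin.≟ u
  ... | yes w≡u = w≡u
  ... | no  w≢u = contradiction (x∈p∧y∈p∧y≢x⇒2≤∣p∣ (Edge⇒∈N e) (Edge⇒∈N e′) w≢u) (<⇒≱ v-leaf)

  ECFF-⊈-non-leaf : ∀ {t B a b} → IsECFF G t B → Edge G a b → 2 ≤ deg G b → B a ⊈ B b
  ECFF-⊈-non-leaf {B = B} {a} {b} ecff e 2≤deg Ba⊆Bb =
    <⇒≱ (s≤s (neighbours≡⇒deg≤1 only-a)) 2≤deg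
    where
    only-a : ∀ c → Edge G b c → c ≡ a
    only-a c e′ with c Fin.≟ a
    ... | yes c≡a = c≡a
    ... | no  c≢a = ⊥-elim (ecff b c a e′ (Edge-irrefl e) (λ a≡c → c≢a (sym a≡c))
                                 λ i∈Ba → p⊆p∪q (B c) (Ba⊆Bb i∈Ba))

  IsSeparating : ∀ {k} → (Fin (n G) → Subset k) → Set
  IsSeparating L = ∀ a b → Edge G a b → deg G b < 2 → L a ⊈ L b

  prefixed-isCFF : ∀ {k t} {L : Fin (n G) → Subset k} {B : Fin (n G) → Subset t} →
    IsECFF G t B → IsSeparating L → IsCFF G (k + t) (λ v → L v ++ B v)
  prefixed-isCFF {L = L} {B} ecff separating =
      (λ a b w e w≢a w≢b incl → ecff a b w e w≢a w≢b
        (++-⊆⁻ʳ (L w) (L a ∪ L b) (subst (_ ⊆_) (zipWith-++ _ (L a) (B a) (L b) (B b)) incl)))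
    , λ a b e → ⊈-along e , ⊈-along (Edge-sym e)
    where
    ⊈-along : ∀ {a b} → Edge G a b → L a ++ B a ⊈ L b ++ B b
    ⊈-along {a} {b} e incl with 2 ≤? deg G b
    ... | yes 2≤deg = ECFF-⊈-non-leaf ecff e 2≤deg (++-⊆⁻ʳ (L a) (L b) incl)
    ... | no  2≰deg = separating a b e (≰⇒> 2≰deg) (++-⊆⁻ˡ (L a) (L b) incl)

  empty-separating : MinDegree≥ G 2 → IsSeparating (λ _ → [])
  empty-separating δ≥2 a b _ b-leaf _ = <⇒≱ b-leaf (δ≥2 b)

  has-degree≥2 : Fin (n G) → Bool
  has-degree≥2 v = does (2 ≤? deg G v)

  degreeMark : Fin (n G) → Subset 1
  degreeMark v = has-degree≥2 v ∷ []

  degreeMark-separating : NoIsolated G → ¬ HasK2Component G → IsSeparating degreeMark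
  degreeMark-separating no-isolated no-K₂ a b e b-leaf with 2 ≤? deg G a
  ... | yes 2≤deg = ∷-⊈ (dec-true (2 ≤? deg G a) 2≤deg) (dec-false (2 ≤? deg G b) (<⇒≱ b-leaf))
  ... | no  2≰deg = contradiction (a , b , e , deg≡1 (≰⇒> 2≰deg) , deg≡1 b-leaf) no-K₂
    where
    deg≡1 : ∀ {v} → deg G v < 2 → deg G v ≡ 1
    deg≡1 {v} v-leaf = ≤-antisym (s≤s⁻¹ v-leaf) (no-isolated v)

  larger-neighbour? : ∀ v → Dec (∃ λ u → Edge G v u × v Fin.< u)
  larger-neighbour? v = any? λ u → (adj G v u ≟ true) ×-dec (v Fin.<? u)

  has-larger-neighbour : Fin (n G) → Bool
  has-larger-neighbour v = does (larger-neighbour? v)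

  leaf-has-larger-neighbour : ∀ {v u} → deg G v < 2 → Edge G v u →
    has-larger-neighbour v ≡ does (v Fin.<? u)
  leaf-has-larger-neighbour {v} {u} v-leaf e = does-⇔ (mk⇔
    (λ { (w , e′ , v<w) → subst (v Fin.<_) (leaf-neighbour-unique v-leaf e e′) v<w })
    (λ v<u → u , e , v<u)) (larger-neighbour? v) (v Fin.<? u)

  orientation : Fin (n G) → Subset 2
  orientation v = orient (has-degree≥2 v) (has-larger-neighbour v)

  orientation-separating : IsSeparating orientation
  orientation-separating a b e b-leaf incl with 2 ≤? deg G a
  ... | yes 2≤deg = orient-⊈ _ _ (dec-true (2 ≤? deg G a) 2≤deg) b-small incl
    where b-small = dec-false (2 ≤? deg G b) (<⇒≱ b-leaf)
  ... | no  2≰deg = not-¬ same-direction (does-<?-flip (Edge-irrefl e))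
    where
    open ≡-Reasoning
    same-direction : does (a Fin.<? b) ≡ does (b Fin.<? a)
    same-direction = begin
      does (a Fin.<? b)          ≡⟨ sym (leaf-has-larger-neighbour (≰⇒> 2≰deg) e) ⟩
      has-larger-neighbour a     ≡⟨ orient-⊆⇒≡ _ _ (dec-false (2 ≤? deg G a) 2≰deg)
                                      (dec-false (2 ≤? deg G b) (<⇒≱ b-leaf)) incl ⟩
      has-larger-neighbour b     ≡⟨ leaf-has-larger-neighbour b-leaf (Edge-sym e) ⟩
      does (b Fin.<? a)          ∎

  HasCFF⇒HasECFF : ∀ {t} → HasCFF G t → HasECFF G t
  HasCFF⇒HasECFF (B , ecff , _) = B , ecff

  IsTe-minimal : ∀ {m k} → IsTe G m → HasECFF G k → m ≤ k
  IsTe-minimal (_ , below) h = ≮⇒≥ λ k<m → below _ k<m h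

  IsT-minimal : ∀ {m k} → IsT G m → HasCFF G k → m ≤ k
  IsT-minimal (_ , below) h = ≮⇒≥ λ k<m → below _ k<m h

theorem4p13 : (G : Graph) → NoIsolated G → (te tt : ℕ) → IsTe G te → IsT G tt →
    (MinDegree≥ G 2 → tt ≡ te)
  × (MinDegree G 1 → ¬ HasK2Component G → te ≤ tt × tt ≤ te + 1)
  × (MinDegree G 1 → te ≤ tt × tt ≤ te + 2)
theorem4p13 G no-isolated te tt te-min@((B , B-ecff) , _) tt-min@(C-cff , _) =
    (λ δ≥2 → ≤-antisym (prefixed-upper (empty-separating G δ≥2)) te≤tt)
  , (λ _ no-K₂ → te≤tt , subst (tt ≤_) (+-comm 1 te)
                           (prefixed-upper (degreeMark-separating G no-isolated no-K₂)))
  , (λ _ → te≤tt , subst (tt ≤_) (+-comm 2 te) (prefixed-upper (orientation-separating G)))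
  where
  te≤tt : te ≤ tt
  te≤tt = IsTe-minimal G te-min (HasCFF⇒HasECFF G C-cff)

  prefixed-upper : ∀ {k} {L : Fin (n G) → Subset k} → IsSeparating G L → tt ≤ k + te
  prefixed-upper separating = IsT-minimal G tt-min (_ , prefixed-isCFF G B-ecff separating)
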